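{- Let $n\ge 3$, let $k\ge 2$, and let $a,b\ge 2$ be integers with $4a+4b=4k+4$. Let $G$ be a spanning subgraph of $CT_n$ containing no cycle of length $4k+2$. Let $C$ and $C'$ be cycles of lengths $4a$ and $4b$ in $G$, respectively. If $C$ and $C'$ have at least one common edge, then $|\mathrm{supp}(C)\cap\mathrm{supp}(C')|\ge 3$.
   Context: $CT_n$ is the graph with vertex set the symmetric group $\mathrm{S}_n$ on $\{1,\dots,n\}$ in which $x,y$ are adjacent iff $y=ux$ for some transposition $u$. For $x\in\mathrm{S}_n$, $\mathrm{supp}(x)=\{i:i^x\ne i\}$; for an edge $\{u,z\}$, $\mathrm{supp}(\{u,z\})=\mathrm{supp}(zu^{ -1})$; for a subgraph $H$, $\mathrm{supp}(H)=\bigcup_{\{u,z\}\in E(H)}\mathrm{supp}(\{u,z\})$. -}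

module Defs where

open import Data.Nat using (ℕ; zero; suc; _≤_; _*_; _+_)
open import Data.Nat.DivMod using (_mod_)
open import Data.Fin using (Fin; toℕ)
open import Data.Fin.Properties using (any?) renaming (_≟_ to _≟ᶠ_)
open import Data.Vec using (Vec; lookup; tabulate; map)
open import Data.Product using (Σ; ∃; ∃-syntax; _×_; _,_)
open import Data.Sum using (_⊎_)
open import Relation.Binary.PropositionalEquality using (_≡_; _≢_)
open import Relation.Nullary using (yes; no; ¬_)

-- An element x of S_n is represented by the vector of images:
-- lookup x i = i^x  (points are Fin n, i.e. {0,…,n-1} standing for {1,…,n}).
Arr : ℕ → Set
Arr n = Vec (Fin n) n

IsPerm : ∀ {n} → Arr n → Set
IsPerm {n} x = ∀ (i j : Fin n) → lookup x i ≡ lookup x j → i ≡ j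

-- Right-action convention of the paper: i^(xy) = (i^x)^y.
_·_ : ∀ {n} → Arr n → Arr n → Arr n
x · y = map (lookup y) x

-- inverse (correct for permutations)
inv : ∀ {n} → Arr n → Arr n
inv {n} x = tabulate f
  where
  f : Fin n → Fin n
  f k with any? (λ j → lookup x j ≟ᶠ k)
  ... | yes (j , _) = j
  ... | no _ = k

transp : ∀ {n} → Fin n → Fin n → Arr n
transp {n} i j = tabulate f
  where
  f : Fin n → Fin n
  f k with k ≟ᶠ i
  ... | yes _ = j
  ... | no _ with k ≟ᶠ j
  ...   | yes _ = i
  ...   | no _ = k

supp : ∀ {n} → Arr n → Fin n → Set
supp x i = lookup x i ≢ i

Adj : ∀ {n} → Arr n → Arr n → Set
Adj {n} x y = IsPerm x × ∃[ i ] ∃[ j ] (i ≢ j × y ≡ transp i j · x)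

edgeSupp : ∀ {n} → Arr n → Arr n → Fin n → Set
edgeSupp u z = supp (z · inv u)

record SpanningSubgraph (n : ℕ) : Set₁ where
  field
    E     : Arr n → Arr n → Set
    E-sym : ∀ {x y} → E x y → E y x
    E-sub : ∀ {x y} → E x y → Adj x y

next : ∀ {L} → Fin L → Fin L
next {suc m} i = suc (toℕ i) mod (suc m)

record Cycle {n} (G : SpanningSubgraph n) (L : ℕ) : Set where
  open SpanningSubgraph G
  field
    len≥3 : 3 ≤ L
    vert  : Fin L → Arr n
    inj   : ∀ i j → vert i ≡ vert j → i ≡ j
    edge  : ∀ i → E (vert i) (vert (next i))

cycleSupp : ∀ {n} {G : SpanningSubgraph n} {L} → Cycle G L → Fin n → Set
cycleSupp C k = ∃[ i ] edgeSupp (vert i) (vert (next i)) k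
  where open Cycle C

CommonEdge : ∀ {n} {G : SpanningSubgraph n} {L L'} → Cycle G L → Cycle G L' → Set
CommonEdge C C' = ∃[ i ] ∃[ j ]
  ((Cycle.vert C i ≡ Cycle.vert C' j × Cycle.vert C (next i) ≡ Cycle.vert C' (next j))
  ⊎ (Cycle.vert C i ≡ Cycle.vert C' (next j) × Cycle.vert C (next i) ≡ Cycle.vert C' j))

AtLeast3Common : ∀ {n} → (Fin n → Set) → (Fin n → Set) → Set
AtLeast3Common {n} P Q = ∃[ p ] ∃[ q ] ∃[ r ]
  (p ≢ q × p ≢ r × q ≢ r × P p × Q p × P q × Q q × P r × Q r)

-- Let xy be the common edge, y = (a b) x.  Along a cycle every step changes a vertex only
-- at points of the cycle's support, so every vertex of C agrees with x off supp C, and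
-- likewise for C'.  If the two supports met only in {a, b}, a vertex lying on both cycles
-- would agree with x off {a, b} and hence be x or y.  Then the arc of C from y to x and
-- the arc of C' from x to y would meet only at their endpoints and glue to a cycle of
-- length 4a + 4b - 2 = 4k + 2 in G.  So the supports share a third point besides a and b,
-- which lie in both since the common edge moves them.
module Submission where

open import Defs
open import Data.Nat using (ℕ; zero; suc; pred; _≤_; _<_; _*_; _+_; _∸_; z≤n; s≤s; _%_; _<?_; NonZero)
open import Data.Nat.Properties
open import Data.Nat.DivMod using (_mod_; %-distribˡ-+; m%n%n≡m%n; [m+n]%n≡m%n; m%n<n; m<n⇒m%n≡m; n%n≡0)
open import Data.Fin using (Fin; toℕ)
open import Data.Fin.Properties using (toℕ-injective; toℕ<n; toℕ-fromℕ<; any?) renaming (_≟_ to _≟ᶠ_)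
open import Data.Vec using (lookup)
open import Data.Vec.Properties using (lookup-map; lookup∘tabulate)
open import Data.Vec.Relation.Binary.Pointwise.Extensional using (ext; Pointwise-≡⇒≡)
open import Data.Product using (∃; _×_; _,_; _,′_; proj₁; proj₂)
open import Data.Sum using (_⊎_; inj₁; inj₂; map₂)
open import Data.Empty using (⊥-elim)
open import Relation.Binary.PropositionalEquality
open import Relation.Nullary using (¬_; Dec; yes; no)
open import Relation.Nullary.Decidable using (¬?; _×-dec_)
open import Function using (case_of_)

lookup-· : ∀ {n} (x y : Arr n) k → lookup (x · y) k ≡ lookup y (lookup x k)
lookup-· x y k = lookup-map k (lookup y) x

-- `inv` and `transp` are `tabulate`s of functions defined by `with`; naming an entry
-- lets the tests inside those functions be split on.
private
  entry-inv : ∀ {n} (x : Arr n) k → ∃ λ r → lookup (inv x) k ≡ r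
  entry-inv x k = _ , lookup∘tabulate _ k

  entry-transp : ∀ {n} (a b k : Fin n) → ∃ λ r → lookup (transp a b) k ≡ r
  entry-transp a b k = _ , lookup∘tabulate _ k

lookup-inv-lookup : ∀ {n} {x : Arr n} → IsPerm x → ∀ j → lookup (inv x) (lookup x j) ≡ j
lookup-inv-lookup {x = x} x-inj j with any? (λ i → lookup x i ≟ᶠ lookup x j) | proj₂ (entry-inv x (lookup x j))
... | yes (i , xi≡xj) | e = trans e (x-inj i j xi≡xj)
... | no ∄i | _ = ⊥-elim (∄i (j , refl))

lookup-transpˡ : ∀ {n} (a b : Fin n) → lookup (transp a b) a ≡ b
lookup-transpˡ a b with a ≟ᶠ a | proj₂ (entry-transp a b a)
... | yes _ | e = e
... | no a≢a | _ = ⊥-elim (a≢a refl)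

lookup-transpʳ : ∀ {n} (a b : Fin n) → lookup (transp a b) b ≡ a
lookup-transpʳ a b with b ≟ᶠ a | proj₂ (entry-transp a b b)
... | yes b≡a | e = trans e b≡a
... | no _ | e with b ≟ᶠ b
...   | yes _ = e
...   | no b≢b = ⊥-elim (b≢b refl)

lookup-transp-other : ∀ {n} (a b k : Fin n) → k ≢ a → k ≢ b → lookup (transp a b) k ≡ k
lookup-transp-other a b k k≢a k≢b with k ≟ᶠ a | proj₂ (entry-transp a b k)
... | yes k≡a | _ = ⊥-elim (k≢a k≡a)
... | no _ | e with k ≟ᶠ b
...   | yes k≡b = ⊥-elim (k≢b k≡b)
...   | no _ = e

lookup-transp·-≢ˡ : ∀ {n} {x : Arr n} {a b} → IsPerm x → a ≢ b → lookup x a ≢ lookup (transp a b · x) a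
lookup-transp·-≢ˡ {x = x} {a} {b} x-inj a≢b e =
  a≢b (x-inj a b (trans e (trans (lookup-· (transp a b) x a) (cong (lookup x) (lookup-transpˡ a b)))))

lookup-transp·-≢ʳ : ∀ {n} {x : Arr n} {a b} → IsPerm x → a ≢ b → lookup x b ≢ lookup (transp a b · x) b
lookup-transp·-≢ʳ {x = x} {a} {b} x-inj a≢b e =
  a≢b (sym (x-inj b a (trans e (trans (lookup-· (transp a b) x b) (cong (lookup x) (lookup-transpʳ a b))))))

agree-off-pair : ∀ {n} {w x : Arr n} {a b : Fin n} → IsPerm w → a ≢ b
  → (∀ k → k ≢ a → k ≢ b → lookup w k ≡ lookup x k)
  → (∀ k → ∃ λ k' → lookup w k ≡ lookup x k')
  → w ≡ x ⊎ w ≡ transp a b · x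
agree-off-pair {w = w} {x} {a} {b} w-inj a≢b agree image
  with value-in-pair a (inj₁ refl) | value-in-pair b (inj₂ refl)
  where
  value-in-pair : ∀ c → c ≡ a ⊎ c ≡ b → lookup w c ≡ lookup x a ⊎ lookup w c ≡ lookup x b
  value-in-pair c c∈ab with image c
  ... | k , wc≡xk with k ≟ᶠ a | k ≟ᶠ b
  ...   | yes refl | _ = inj₁ wc≡xk
  ...   | no _ | yes refl = inj₂ wc≡xk
  ...   | no k≢a | no k≢b with w-inj c k (trans wc≡xk (sym (agree k k≢a k≢b)))
  ...     | refl with c∈ab
  ...       | inj₁ k≡a = ⊥-elim (k≢a k≡a)
  ...       | inj₂ k≡b = ⊥-elim (k≢b k≡b)
... | inj₁ wa≡xa | inj₁ wb≡xa = ⊥-elim (a≢b (w-inj a b (trans wa≡xa (sym wb≡xa))))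
... | inj₂ wa≡xb | inj₂ wb≡xb = ⊥-elim (a≢b (w-inj a b (trans wa≡xb (sym wb≡xb))))
... | inj₁ wa≡xa | inj₂ wb≡xb = inj₁ (Pointwise-≡⇒≡ (ext pointwise))
  where
  pointwise : ∀ k → lookup w k ≡ lookup x k
  pointwise k with k ≟ᶠ a | k ≟ᶠ b
  ... | yes refl | _ = wa≡xa
  ... | no _ | yes refl = wb≡xb
  ... | no k≢a | no k≢b = agree k k≢a k≢b
... | inj₂ wa≡xb | inj₁ wb≡xa = inj₂ (Pointwise-≡⇒≡ (ext pointwise))
  where
  pointwise : ∀ k → lookup w k ≡ lookup (transp a b · x) k
  pointwise k rewrite lookup-· (transp a b) x k with k ≟ᶠ a | k ≟ᶠ b
  ... | yes refl | _ = trans wa≡xb (cong (lookup x) (sym (lookup-transpˡ a b)))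
  ... | no _ | yes refl = trans wb≡xa (cong (lookup x) (sym (lookup-transpʳ a b)))
  ... | no k≢a | no k≢b = trans (agree k k≢a k≢b) (cong (lookup x) (sym (lookup-transp-other a b k k≢a k≢b)))

-- For permutations the image conditions are automatic; they are needed here because
-- IsPerm only asserts injectivity.
record AgreeOff {n} (S : Fin n → Set) (x y : Arr n) : Set where
  field
    agree  : ∀ k → ¬ S k → lookup x k ≡ lookup y k
    image⊆ : ∀ k → ∃ λ k' → lookup x k ≡ lookup y k'
    image⊇ : ∀ k → ∃ λ k' → lookup y k ≡ lookup x k'
open AgreeOff

AgreeOff-refl : ∀ {n} {S : Fin n → Set} {x} → AgreeOff S x x
AgreeOff-refl = record { agree = λ _ _ → refl ; image⊆ = λ k → k , refl ; image⊇ = λ k → k , refl }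

AgreeOff-sym : ∀ {n} {S : Fin n → Set} {x y} → AgreeOff S x y → AgreeOff S y x
AgreeOff-sym x∼y = record
  { agree = λ k k∉S → sym (agree x∼y k k∉S) ; image⊆ = image⊇ x∼y ; image⊇ = image⊆ x∼y }

AgreeOff-trans : ∀ {n} {S : Fin n → Set} {x y z} → AgreeOff S x y → AgreeOff S y z → AgreeOff S x z
AgreeOff-trans x∼y y∼z = record
  { agree  = λ k k∉S → trans (agree x∼y k k∉S) (agree y∼z k k∉S)
  ; image⊆ = λ k → let (k' , e) = image⊆ x∼y k ; (k'' , e') = image⊆ y∼z k' in k'' , trans e e'
  ; image⊇ = λ k → let (k' , e) = image⊇ y∼z k ; (k'' , e') = image⊇ x∼y k' in k'' , trans e e'
  }

AgreeOff-∩ : ∀ {n} {S T : Fin n → Set} {x y} → AgreeOff S x y → AgreeOff T x y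
  → ∀ k → ¬ (S k × T k) → lookup x k ≡ lookup y k
AgreeOff-∩ {x = x} {y} x∼ˢy x∼ᵀy k k∉S∩T with lookup x k ≟ᶠ lookup y k
... | yes xk≡yk = xk≡yk
... | no xk≢yk = ⊥-elim (xk≢yk (agree x∼ˢy k λ k∈S → xk≢yk (agree x∼ᵀy k λ k∈T → k∉S∩T (k∈S , k∈T))))

[m+n%d]%d≡[m+n]%d : ∀ m n d .{{_ : NonZero d}} → (m + n % d) % d ≡ (m + n) % d
[m+n%d]%d≡[m+n]%d m n d = begin
  (m + n % d) % d            ≡⟨ %-distribˡ-+ m (n % d) d ⟩
  (m % d + n % d % d) % d    ≡⟨ cong (λ r → (m % d + r) % d) (m%n%n≡m%n n d) ⟩
  (m % d + n % d) % d        ≡⟨ %-distribˡ-+ m n d ⟨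
  (m + n) % d                ∎
  where open ≡-Reasoning

module _ {N₀ : ℕ} where
  private
    N : ℕ
    N = suc N₀

  toℕ-mod : ∀ x → toℕ (x mod N) ≡ x % N
  toℕ-mod x = toℕ-fromℕ< (m%n<n x N)

  %-≡⇒mod-≡ : ∀ x y → x % N ≡ y % N → x mod N ≡ y mod N
  %-≡⇒mod-≡ x y e = toℕ-injective (trans (toℕ-mod x) (trans e (sym (toℕ-mod y))))

  toℕ-mod-inverse : (q : Fin N) → toℕ q mod N ≡ q
  toℕ-mod-inverse q = toℕ-injective (trans (toℕ-mod (toℕ q)) (m<n⇒m%n≡m (toℕ<n q)))

  next-mod : ∀ x → next (x mod N) ≡ suc x mod N
  next-mod x = %-≡⇒mod-≡ (suc (toℕ (x mod N))) (suc x) (trans (cong (λ r → suc r % N) (toℕ-mod x)) ([m+n%d]%d≡[m+n]%d 1 x N))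

  mod-periodic : ∀ x → (x + N) mod N ≡ x mod N
  mod-periodic x = %-≡⇒mod-≡ (x + N) x ([m+n]%n≡m%n x N)

  +-mod-cancelˡ : ∀ {c m m'} → c ≤ N → m < N → m' < N → (c + m) mod N ≡ (c + m') mod N → m ≡ m'
  +-mod-cancelˡ {c} {m} {m'} c≤N m<N m'<N e = begin
    m                       ≡⟨ unshift m<N ⟨
    (N ∸ c + (c + m) % N) % N   ≡⟨ cong (λ r → (N ∸ c + r) % N) %-equal ⟩
    (N ∸ c + (c + m') % N) % N  ≡⟨ unshift m'<N ⟩
    m'                      ∎
    where
    open ≡-Reasoning
    %-equal : (c + m) % N ≡ (c + m') % N
    %-equal = trans (sym (toℕ-mod (c + m))) (trans (cong toℕ e) (toℕ-mod (c + m')))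
    unshift : ∀ {k} → k < N → (N ∸ c + (c + k) % N) % N ≡ k
    unshift {k} k<N = begin
      (N ∸ c + (c + k) % N) % N  ≡⟨ [m+n%d]%d≡[m+n]%d (N ∸ c) (c + k) N ⟩
      (N ∸ c + (c + k)) % N      ≡⟨ cong (_% N) (trans (sym (+-assoc (N ∸ c) c k)) (trans (cong (_+ k) (m∸n+n≡m c≤N)) (+-comm N k))) ⟩
      (k + N) % N                ≡⟨ [m+n]%n≡m%n k N ⟩
      k % N                      ≡⟨ m<n⇒m%n≡m k<N ⟩
      k                          ∎

record Path {n} (G : SpanningSubgraph n) (u v : Arr n) (len : ℕ) : Set where
  open SpanningSubgraph G
  field
    vertex    : ℕ → Arr n
    start     : vertex 0 ≡ u
    end       : vertex len ≡ v
    edge      : ∀ m → m < len → E (vertex m) (vertex (suc m))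
    injective : ∀ {m m'} → m ≤ len → m' ≤ len → vertex m ≡ vertex m' → m ≡ m'

module _ {n} {G : SpanningSubgraph n} where
  open SpanningSubgraph G

  Path-reverse : ∀ {u v len} → Path G u v len → Path G v u len
  Path-reverse {len = len} P = record
    { vertex    = λ m → vertex (len ∸ m)
    ; start     = end
    ; end       = trans (cong vertex (n∸n≡0 len)) start
    ; edge      = λ m m<len → E-sym (subst (λ i → E (vertex (len ∸ suc m)) (vertex i))
                                            (suc-len∸suc m<len) (edge _ (len∸suc<len m<len)))
    ; injective = λ {m} {m'} m≤len m'≤len e →
                    ∸-cancelˡ-≡ m≤len m'≤len (injective (m∸n≤m len m) (m∸n≤m len m') e)
    }
    where
    open Path P
    suc-len∸suc : ∀ {m} → m < len → suc (len ∸ suc m) ≡ len ∸ m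
    suc-len∸suc m<len = sym (+-∸-assoc 1 m<len)
    len∸suc<len : ∀ {m} → m < len → len ∸ suc m < len
    len∸suc<len {m} m<len = ≤-trans (≤-reflexive (suc-len∸suc m<len)) (m∸n≤m len m)

  Path-cong : ∀ {u u' v v' len} → u ≡ u' → v ≡ v' → Path G u v len → Path G u' v' len
  Path-cong u≡u' v≡v' P = record
    { vertex = vertex ; start = trans start u≡u' ; end = trans end v≡v' ; edge = edge ; injective = injective }
    where open Path P

  Path-vertex≡end : ∀ {u v len} (P : Path G u v len) {m} → m ≤ len → Path.vertex P m ≡ v → m ≡ len
  Path-vertex≡end P m≤len e = Path.injective P m≤len ≤-refl (trans e (sym (Path.end P)))

  closed-walk⇒Cycle : ∀ {N} (f : ℕ → Arr n) → 3 ≤ N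
    → (∀ m → m < N → E (f m) (f (suc m))) → f N ≡ f 0
    → (∀ {m m'} → m < N → m' < N → f m ≡ f m' → m ≡ m')
    → Cycle G N
  closed-walk⇒Cycle {N@(suc _)} f 3≤N step closed f-inj = record
    { len≥3 = 3≤N
    ; vert  = λ q → f (toℕ q)
    ; inj   = λ p q e → toℕ-injective (f-inj (toℕ<n p) (toℕ<n q) e)
    ; edge  = λ q → subst (λ r → E (f (toℕ q)) (f r))
                         (sym (toℕ-mod (suc (toℕ q))))
                         (subst (E (f (toℕ q))) (sym (wrap (toℕ<n q))) (step (toℕ q) (toℕ<n q)))
    }
    where
    wrap : ∀ {m} → m < N → f (suc m % N) ≡ f (suc m)
    wrap m<N with m≤n⇒m<n∨m≡n m<N
    ... | inj₁ 1+m<N = cong f (m<n⇒m%n≡m 1+m<N)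
    ... | inj₂ refl  = trans (cong f (n%n≡0 N)) (sym closed)

  module _ {u v p q} (P : Path G u v p) (Q : Path G v u q) where
    private
      module P = Path P
      module Q = Path Q

      glued : ℕ → Arr n
      glued m with m <? p
      ... | yes _ = P.vertex m
      ... | no _  = Q.vertex (m ∸ p)

      glued-< : ∀ {m} → m < p → glued m ≡ P.vertex m
      glued-< {m} m<p with m <? p
      ... | yes _ = refl
      ... | no m≮p = ⊥-elim (m≮p m<p)

      glued-≥ : ∀ {m} → p ≤ m → glued m ≡ Q.vertex (m ∸ p)
      glued-≥ {m} p≤m with m <? p
      ... | yes m<p = ⊥-elim (<⇒≱ m<p p≤m)
      ... | no _ = refl

      glued-≤ : ∀ {m} → m ≤ p → glued m ≡ P.vertex m
      glued-≤ m≤p with m≤n⇒m<n∨m≡n m≤p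
      ... | inj₁ m<p = glued-< m<p
      ... | inj₂ refl = trans (glued-≥ ≤-refl) (trans (cong Q.vertex (n∸n≡0 p)) (trans Q.start (sym P.end)))

      ∸p< : ∀ {m} → p ≤ m → m < p + q → m ∸ p < q
      ∸p< {m} p≤m m<p+q = subst (m ∸ p <_) (m+n∸m≡n p q) (∸-monoˡ-< m<p+q p≤m)

      glued-step : ∀ m → m < p + q → E (glued m) (glued (suc m))
      glued-step m m<p+q = case m <? p of λ where
        (yes m<p) → subst₂ E (sym (glued-< m<p)) (sym (glued-≤ m<p)) (P.edge m m<p)
        (no m≮p)  → let p≤m = ≮⇒≥ m≮p in
          subst₂ E (sym (glued-≥ p≤m))
                   (sym (trans (glued-≥ (m≤n⇒m≤1+n p≤m)) (cong Q.vertex (+-∸-assoc 1 p≤m))))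
                   (Q.edge (m ∸ p) (∸p< p≤m m<p+q))

      glued-closed : glued (p + q) ≡ glued 0
      glued-closed = begin
        glued (p + q)          ≡⟨ glued-≥ (m≤m+n p q) ⟩
        Q.vertex (p + q ∸ p)   ≡⟨ cong Q.vertex (m+n∸m≡n p q) ⟩
        Q.vertex q             ≡⟨ trans Q.end (sym P.start) ⟩
        P.vertex 0             ≡⟨ glued-≤ z≤n ⟨
        glued 0                ∎
        where open ≡-Reasoning

    Path-glue : 3 ≤ p + q → (∀ {m r} → m < p → r < q → P.vertex m ≢ Q.vertex r) → Cycle G (p + q)
    Path-glue 3≤p+q disjoint = closed-walk⇒Cycle glued 3≤p+q glued-step glued-closed glued-injective
      where
      open ≡-Reasoning
      P≢Q : ∀ {m m'} → m < p → ¬ m' < p → m' < p + q → glued m ≢ glued m'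
      P≢Q m<p m'≮p m'< e =
        disjoint m<p (∸p< (≮⇒≥ m'≮p) m'<) (trans (sym (glued-< m<p)) (trans e (glued-≥ (≮⇒≥ m'≮p))))
      glued-injective : ∀ {m m'} → m < p + q → m' < p + q → glued m ≡ glued m' → m ≡ m'
      glued-injective {m} {m'} m< m'< e = case (m <? p) ,′ (m' <? p) of λ where
        (yes m<p , yes m'<p) →
          P.injective (<⇒≤ m<p) (<⇒≤ m'<p) (trans (sym (glued-< m<p)) (trans e (glued-< m'<p)))
        (yes m<p , no m'≮p) → ⊥-elim (P≢Q m<p m'≮p m'< e)
        (no m≮p , yes m'<p) → ⊥-elim (P≢Q m'<p m≮p m< (sym e))
        (no m≮p , no m'≮p) → begin
          m              ≡⟨ m∸n+n≡m (≮⇒≥ m≮p) ⟨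
          m ∸ p + p      ≡⟨ cong (_+ p) (Q.injective (<⇒≤ (∸p< (≮⇒≥ m≮p) m<)) (<⇒≤ (∸p< (≮⇒≥ m'≮p) m'<))
                               (trans (sym (glued-≥ (≮⇒≥ m≮p))) (trans e (glued-≥ (≮⇒≥ m'≮p))))) ⟩
          m' ∸ p + p     ≡⟨ m∸n+n≡m (≮⇒≥ m'≮p) ⟩
          m'             ∎

  edge-image : ∀ {x y} → E x y → ∀ k → ∃ λ k' → lookup y k ≡ lookup x k'
  edge-image {x} x—y k with E-sub x—y
  ... | _ , i , j , _ , refl = lookup (transp i j) k , lookup-· (transp i j) x k

  edge-diff⇒edgeSupp : ∀ {x y} → E x y → ∀ {k} → lookup x k ≢ lookup y k → edgeSupp x y k
  edge-diff⇒edgeSupp {x} x—y {k} xk≢yk yx⁻¹k≡k with E-sub x—y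
  ... | x-inj , i , j , _ , refl = xk≢yk (sym (trans (lookup-· t x k) (cong (lookup x) tk≡k)))
    where
    open ≡-Reasoning
    t = transp i j
    tk≡k : lookup t k ≡ k
    tk≡k = begin
      lookup t k                                ≡⟨ lookup-inv-lookup x-inj (lookup t k) ⟨
      lookup (inv x) (lookup x (lookup t k))    ≡⟨ cong (lookup (inv x)) (lookup-· t x k) ⟨
      lookup (inv x) (lookup (t · x) k)         ≡⟨ lookup-· (t · x) (inv x) k ⟨
      lookup ((t · x) · inv x) k                ≡⟨ yx⁻¹k≡k ⟩
      k                                         ∎

  edge⇒AgreeOff : ∀ {S : Fin n → Set} {x y} → E x y → (∀ k → lookup x k ≢ lookup y k → S k) → AgreeOff S x y
  edge⇒AgreeOff {x = x} {y} x—y diff⊆S = record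
    { agree  = agree′
    ; image⊆ = edge-image (E-sym x—y)
    ; image⊇ = edge-image x—y
    }
    where
    agree′ : ∀ k → ¬ _ → lookup x k ≡ lookup y k
    agree′ k k∉S with lookup x k ≟ᶠ lookup y k
    ... | yes xk≡yk = xk≡yk
    ... | no xk≢yk = ⊥-elim (k∉S (diff⊆S k xk≢yk))

  module _ {L₀} (C : Cycle G (suc L₀)) where
    open Cycle C

    VertexOf : Arr n → Set
    VertexOf w = ∃ λ p → w ≡ vert p

    EdgeOf : Arr n → Arr n → Set
    EdgeOf u v = ∃ λ i → (u ≡ vert i × v ≡ vert (next i)) ⊎ (u ≡ vert (next i) × v ≡ vert i)

    cycleSupp? : ∀ k → Dec (cycleSupp C k)
    cycleSupp? k = any? (λ p → ¬? (lookup (vert (next p) · inv (vert p)) k ≟ᶠ k))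

    edge-diff⇒cycleSupp : ∀ i {k} → lookup (vert i) k ≢ lookup (vert (next i)) k → cycleSupp C k
    edge-diff⇒cycleSupp i d = i , edge-diff⇒edgeSupp (edge i) d

    walk : ℕ → Arr n
    walk x = vert (x mod suc L₀)

    walk-edge : ∀ x → E (walk x) (walk (suc x))
    walk-edge x = subst (λ q → E (walk x) (vert q)) (next-mod x) (edge (x mod suc L₀))

    walk-AgreeOff : ∀ x → AgreeOff (cycleSupp C) (walk x) (walk 0)
    walk-AgreeOff zero    = AgreeOff-refl
    walk-AgreeOff (suc x) = AgreeOff-trans (AgreeOff-sym (edge⇒AgreeOff (walk-edge x) diff⊆supp)) (walk-AgreeOff x)
      where
      diff⊆supp : ∀ k → lookup (walk x) k ≢ lookup (walk (suc x)) k → cycleSupp C k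
      diff⊆supp k d = edge-diff⇒cycleSupp (x mod suc L₀) (λ e → d (trans e (cong (λ q → lookup (vert q) k) (next-mod x))))

    VertexOf-AgreeOff : ∀ {w w'} → VertexOf w → VertexOf w' → AgreeOff (cycleSupp C) w w'
    VertexOf-AgreeOff (p , refl) (p' , refl) =
      subst₂ (AgreeOff (cycleSupp C)) (walk-toℕ p) (walk-toℕ p')
             (AgreeOff-trans (walk-AgreeOff (toℕ p)) (AgreeOff-sym (walk-AgreeOff (toℕ p'))))
      where
      walk-toℕ : ∀ q → walk (toℕ q) ≡ vert q
      walk-toℕ q = cong vert (toℕ-mod-inverse q)

    VertexOf-IsPerm : ∀ {w} → VertexOf w → IsPerm w
    VertexOf-IsPerm (p , refl) = proj₁ (E-sub (edge p))

    arc : ∀ i → Path G (vert (next i)) (vert i) L₀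
    arc i = record
      { vertex    = λ m → walk (suc (toℕ i) + m)
      ; start     = cong vert (begin
          (suc (toℕ i) + 0) mod suc L₀  ≡⟨ cong (_mod suc L₀) (+-identityʳ (suc (toℕ i))) ⟩
          suc (toℕ i) mod suc L₀        ≡⟨ next-mod (toℕ i) ⟨
          next (toℕ i mod suc L₀)       ≡⟨ cong next (toℕ-mod-inverse i) ⟩
          next i                        ∎)
      ; end       = cong vert (begin
          (suc (toℕ i) + L₀) mod suc L₀  ≡⟨ cong (_mod suc L₀) (+-suc (toℕ i) L₀) ⟨
          (toℕ i + suc L₀) mod suc L₀    ≡⟨ mod-periodic (toℕ i) ⟩
          toℕ i mod suc L₀               ≡⟨ toℕ-mod-inverse i ⟩
          i                              ∎)
      ; edge      = λ m _ → subst (λ x → E (walk (suc (toℕ i) + m)) (walk x))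
                                  (sym (+-suc (suc (toℕ i)) m)) (walk-edge (suc (toℕ i) + m))
      ; injective = λ m≤L₀ m'≤L₀ e → +-mod-cancelˡ (toℕ<n i) (s≤s m≤L₀) (s≤s m'≤L₀) (inj _ _ e)
      }
      where open ≡-Reasoning

    EdgeOf-sym : ∀ {u v} → EdgeOf u v → EdgeOf v u
    EdgeOf-sym (i , inj₁ (u≡ , v≡)) = i , inj₂ (v≡ , u≡)
    EdgeOf-sym (i , inj₂ (u≡ , v≡)) = i , inj₁ (v≡ , u≡)

    EdgeOf⇒VertexOf : ∀ {u v} → EdgeOf u v → VertexOf u
    EdgeOf⇒VertexOf (i , inj₁ (u≡ , _)) = i , u≡
    EdgeOf⇒VertexOf (i , inj₂ (u≡ , _)) = next i , u≡

    EdgeOf-diff⇒cycleSupp : ∀ {u v} → EdgeOf u v → ∀ {k} → lookup u k ≢ lookup v k → cycleSupp C k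
    EdgeOf-diff⇒cycleSupp (i , inj₁ (refl , refl)) d = edge-diff⇒cycleSupp i d
    EdgeOf-diff⇒cycleSupp (i , inj₂ (refl , refl)) d = edge-diff⇒cycleSupp i (λ e → d (sym e))

    EdgeOf⇒Path : ∀ {u v} → EdgeOf u v → Path G v u L₀
    EdgeOf⇒Path (i , inj₁ (u≡ , v≡)) = Path-cong (sym v≡) (sym u≡) (arc i)
    EdgeOf⇒Path (i , inj₂ (u≡ , v≡)) = Path-cong (sym v≡) (sym u≡) (Path-reverse (arc i))

    EdgeOf⇒Path-VertexOf : ∀ {u v} (uv : EdgeOf u v) m → VertexOf (Path.vertex (EdgeOf⇒Path uv) m)
    EdgeOf⇒Path-VertexOf (i , inj₁ _) m = _ , refl
    EdgeOf⇒Path-VertexOf (i , inj₂ _) m = _ , refl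

  module _ {L₀ L₁} (C : Cycle G (suc L₀)) (C' : Cycle G (suc L₁)) where

    -- A common vertex agrees with x off supp C and off supp C', hence off {a, b}.
    common-vertex≡⊎≡transp· : ∀ {x a b} → VertexOf C x → VertexOf C' x → a ≢ b
      → (∀ k → k ≢ a → k ≢ b → ¬ (cycleSupp C k × cycleSupp C' k))
      → ∀ {w} → VertexOf C w → VertexOf C' w → w ≡ x ⊎ w ≡ transp a b · x
    common-vertex≡⊎≡transp· x∈C x∈C' a≢b only-a-b w∈C w∈C' =
      agree-off-pair (VertexOf-IsPerm C w∈C) a≢b
        (λ k k≢a k≢b → AgreeOff-∩ w∼x w∼'x k (only-a-b k k≢a k≢b)) (image⊆ w∼x)
      where
      w∼x = VertexOf-AgreeOff C w∈C x∈C
      w∼'x = VertexOf-AgreeOff C' w∈C' x∈C'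

    glue-at-common-edge : ∀ {x y} → EdgeOf C x y → EdgeOf C' x y
      → (∀ {w} → VertexOf C w → VertexOf C' w → w ≡ x ⊎ w ≡ y)
      → Cycle G (L₀ + L₁)
    glue-at-common-edge {x} {y} xy∈C xy∈C' common≡x⊎≡y = Path-glue P Q length disjoint
      where
      P : Path G y x L₀
      P = EdgeOf⇒Path C xy∈C
      Q : Path G x y L₁
      Q = EdgeOf⇒Path C' (EdgeOf-sym C' xy∈C')

      length : 3 ≤ L₀ + L₁
      length = ≤-trans (n≤1+n 3) (+-mono-≤ (≤-pred (Cycle.len≥3 C)) (≤-pred (Cycle.len≥3 C')))

      disjoint : ∀ {m r} → m < L₀ → r < L₁ → Path.vertex P m ≢ Path.vertex Q r
      disjoint {m} {r} m<L₀ r<L₁ Pm≡Qr with common≡x⊎≡y w∈C w∈C'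
        where
        w∈C = EdgeOf⇒Path-VertexOf C xy∈C m
        w∈C' = subst (VertexOf C') (sym Pm≡Qr) (EdgeOf⇒Path-VertexOf C' (EdgeOf-sym C' xy∈C') r)
      ... | inj₁ Pm≡x = <-irrefl (Path-vertex≡end P (<⇒≤ m<L₀) Pm≡x) m<L₀
      ... | inj₂ Pm≡y = <-irrefl (Path-vertex≡end Q (<⇒≤ r<L₁) (trans (sym Pm≡Qr) Pm≡y)) r<L₁

    no-glued-cycle⇒three-common-supp : CommonEdge C C' → ¬ Cycle G (L₀ + L₁)
      → AtLeast3Common (cycleSupp C) (cycleSupp C')
    no-glued-cycle⇒three-common-supp (i , j , shared) no-cycle with E-sub (Cycle.edge C i)
    ... | x-inj , a , b , a≢b , y≡t·x = case any? third? of λ where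
        (yes (k , k≢a , k≢b , k∈S , k∈S')) →
          a , b , k , a≢b , ≢-sym k≢a , ≢-sym k≢b ,
          in-S xa≢ya , in-S' xa≢ya , in-S xb≢yb , in-S' xb≢yb , k∈S , k∈S'
        (no ∄third) → ⊥-elim (no-cycle (glue-at-common-edge xy∈C xy∈C' (common≡x⊎≡y ∄third)))
      where
      x = Cycle.vert C i
      y = Cycle.vert C (next i)
      xy∈C : EdgeOf C x y
      xy∈C = i , inj₁ (refl , refl)
      xy∈C' : EdgeOf C' x y
      xy∈C' = j , shared

      third? : ∀ k → Dec (k ≢ a × k ≢ b × cycleSupp C k × cycleSupp C' k)
      third? k = ¬? (k ≟ᶠ a) ×-dec ¬? (k ≟ᶠ b) ×-dec cycleSupp? C k ×-dec cycleSupp? C' k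

      xa≢ya : lookup x a ≢ lookup y a
      xa≢ya e = lookup-transp·-≢ˡ {x = x} x-inj a≢b (trans e (cong (λ z → lookup z a) y≡t·x))
      xb≢yb : lookup x b ≢ lookup y b
      xb≢yb e = lookup-transp·-≢ʳ {x = x} x-inj a≢b (trans e (cong (λ z → lookup z b) y≡t·x))
      in-S : ∀ {k} → lookup x k ≢ lookup y k → cycleSupp C k
      in-S = EdgeOf-diff⇒cycleSupp C xy∈C
      in-S' : ∀ {k} → lookup x k ≢ lookup y k → cycleSupp C' k
      in-S' = EdgeOf-diff⇒cycleSupp C' xy∈C'

      common≡x⊎≡y : ¬ (∃ λ k → k ≢ a × k ≢ b × cycleSupp C k × cycleSupp C' k)
        → ∀ {w} → VertexOf C w → VertexOf C' w → w ≡ x ⊎ w ≡ y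
      common≡x⊎≡y ∄third w∈C w∈C' = map₂ (λ w≡t·x → trans w≡t·x (sym y≡t·x))
        (common-vertex≡⊎≡transp· (EdgeOf⇒VertexOf C xy∈C) (EdgeOf⇒VertexOf C' xy∈C') a≢b
          (λ k k≢a k≢b (k∈S , k∈S') → ∄third (k , k≢a , k≢b , k∈S , k∈S')) w∈C w∈C')

lemma3p2 : (n k a b : ℕ) → 3 ≤ n → 2 ≤ k → 2 ≤ a → 2 ≤ b
    → 4 * a + 4 * b ≡ 4 * k + 4
    → (G : SpanningSubgraph n) → ¬ Cycle G (4 * k + 2)
    → (C : Cycle G (4 * a)) (C' : Cycle G (4 * b))
    → CommonEdge C C'
    → AtLeast3Common (cycleSupp C) (cycleSupp C')
-- Matching a and b as successors makes 4 * a and 4 * b reduce to the form suc L the cycle lemmas need.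
lemma3p2 n k a@(suc _) b@(suc _) _ _ _ _ 4a+4b≡4k+4 G no-cycle C C' shared =
  no-glued-cycle⇒three-common-supp C C' shared (λ D → no-cycle (subst (Cycle G) length D))
  where
  length : pred (4 * a) + pred (4 * b) ≡ 4 * k + 2
  length = suc-injective (suc-injective (begin
    suc (suc (pred (4 * a) + pred (4 * b)))  ≡⟨ cong suc (+-suc (pred (4 * a)) (pred (4 * b))) ⟨
    4 * a + 4 * b                            ≡⟨ 4a+4b≡4k+4 ⟩
    4 * k + 4                                ≡⟨ +-assoc (4 * k) 2 2 ⟨
    4 * k + 2 + 2                            ≡⟨ +-comm (4 * k + 2) 2 ⟩
    suc (suc (4 * k + 2))                    ∎))
    where open ≡-Reasoning
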